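{- There exist positive constants $a$ and $b$ such that for all sufficiently large $n$, $$a\sqrt{n}\le\chi'_{C_4}(n)\le b\sqrt{n}\log n.$$
   Context: For a graph $G$ and a set $\mathcal H$ of small graphs, an $\mathcal H$-avoiding bipartite partition of $G$ is a collection of bipartite graphs $G_1,\dots,G_k$ (subgraphs of $G$) whose edge sets are pairwise disjoint with union $E(G)$, such that no $G_i$ contains any member of $\mathcal H$ as an induced subgraph. $\chi'_{\mathcal H}(G)$ is the smallest $k$ for which such a partition with $k$ graphs exists, and $\chi'_{\mathcal H}(n):=\chi'_{\mathcal H}(K_n)$, where $K_n$ is the complete graph on $n$ vertices; for $\mathcal H=\{H\}$ one writes $\chi'_H$. $C_4$ is the cycle on 4 vertices. -}

module Defs where

open import Data.Nat using (ℕ; _*_; _≤_)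
open import Data.Fin using (Fin)
open import Data.Bool using (Bool)
open import Data.Product using (Σ; _×_; ∃)
open import Relation.Binary.PropositionalEquality using (_≡_; _≢_)

-- An edge partition of K_n into k subgraphs G_0,…,G_{k-1}, given by the
-- (colour) index of the part containing each edge {u,v} (u ≢ v).
-- Values on the diagonal u ≡ v are irrelevant.  Parts may be empty.
EdgeColouring : ℕ → ℕ → Set
EdgeColouring n k = Fin n → Fin n → Fin k

-- the colouring is well defined on unordered edges
Symmetric : ∀ {n k} → EdgeColouring n k → Set
Symmetric {n} c = (u v : Fin n) → u ≢ v → c u v ≡ c v u

PartBipartite : ∀ {n k} → EdgeColouring n k → Fin k → Set
PartBipartite {n} c i =
  Σ (Fin n → Bool) λ side →
    (u v : Fin n) → u ≢ v → c u v ≡ i → side u ≢ side v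

HasInducedC4 : ∀ {n k} → EdgeColouring n k → Fin k → Set
HasInducedC4 {n} c i =
  Σ (Fin n) λ v0 → Σ (Fin n) λ v1 → Σ (Fin n) λ v2 → Σ (Fin n) λ v3 →
    (v0 ≢ v1 × v0 ≢ v2 × v0 ≢ v3 × v1 ≢ v2 × v1 ≢ v3 × v2 ≢ v3) ×
    (c v0 v1 ≡ i × c v1 v2 ≡ i × c v2 v3 ≡ i × c v3 v0 ≡ i) ×
    (c v0 v2 ≢ i × c v1 v3 ≢ i)

IsC4AvoidingBipartitePartition : ∀ {n k} → EdgeColouring n k → Set
IsC4AvoidingBipartitePartition {n} {k} c =
  Symmetric c ×
  ((i : Fin k) → PartBipartite c i) ×
  ((i : Fin k) → HasInducedC4 c i → Data.Empty.⊥)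
  where import Data.Empty

-- K_n has a C_4-avoiding bipartite partition into k parts
-- (so χ'_{C4}(n) ≤ k holds iff HasPartition n k' for some k' ≤ k)
HasPartition : ℕ → ℕ → Set
HasPartition n k = Σ (EdgeColouring n k) IsC4AvoidingBipartitePartition

{-# OPTIONS --safe #-}

-- In a C₄-avoiding bipartite partition into k parts fix x ≠ y: two vertices v ≠ w
-- with vx, vy, wx, wy all in one part would span an induced C₄ (bipartiteness excludes both
-- diagonals), so at most k vertices see x and y in a common colour. Counting these monochromatic
-- wedges x–v–y against Cauchy–Schwarz for the colour degrees at each vertex gives
-- n (n − 1)² ≤ k n² (k + 1), hence n ≤ 9k².
--
-- Write a vertex as z = y + p x + p² b with x, y < p and a block b < M ≈ n / p².
-- Pairs inside a block are split into bipartite classes by their lowest differing bit, pairs from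
-- blocks b ≠ b′ by b + b′ (smaller block on one side): T + 1 + 2M classes, in each of which the
-- neighbours of a vertex lie in a single block. Refining every class by y_l + y_r + x_l x_r mod p,
-- with l the endpoint on the first side, leaves no 4-cycle, since one would force
-- (x_l − x_l′)(x_r − x_r′) ≡ 0 mod p. A prime p between √n / (2 log n) and √n exists because
-- lcm(1, …, 2m + 1) ≥ 2^m, and then (T + 1 + 2M) p = O(√n log n).

module Submission where

open import Defs
open import Data.Nat
open import Data.Nat.Properties
open import Data.Nat.DivMod
open import Data.Nat.Divisibility
open import Data.Nat.Primality
open import Data.Nat.Primality.Factorisation using (factorise)
open import Data.Nat.Combinatorics using (_C_; nC1≡n; nCk+nC[k+1]≡[n+1]C[k+1])
open import Data.Nat.ListAction using (product)
open import Data.Nat.Induction using (<-rec)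
open import Data.Nat.Logarithm using (⌊log₂_⌋; ⌊log₂⌋-mono-≤; ⌊log₂[2^n]⌋≡n)
open import Data.Nat.Tactic.RingSolver using (solve-∀)
open import Data.Bool using (Bool; true; false; not; if_then_else_)
open import Data.Bool.Properties as Bool using (¬-not)
open import Data.Empty using (⊥; ⊥-elim)
open import Data.Fin using (Fin; zero; suc; toℕ; fromℕ<; combine; remQuot)
open import Data.Fin.Properties as Fin using (any?; toℕ<n; toℕ-fromℕ<; toℕ-injective; fromℕ<-cong; remQuot-combine)
open import Data.List using ([]; _∷_)
open import Data.List.Relation.Unary.All using (_∷_)
open import Data.Product using (Σ; ∃-syntax; ∃₂; _×_; _,_; proj₁; proj₂)
open import Data.Sum using (_⊎_; inj₁; inj₂; [_,_]) renaming (map to ⊎-map)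
open import Function using (id; _∘_)
open import Relation.Nullary using (¬_; Dec; yes; no; does; ¬?; _×-dec_; contradiction)
open import Relation.Unary using (Pred; Decidable)
open import Relation.Binary.PropositionalEquality hiding ([_])
open import Algebra.Properties.Semiring.Sum +-*-semiring
  using (sum; sum-syntax; sum-cong-≗; sum-replicate-zero; ∑-distrib-+; ∑-comm; *-distribˡ-sum; *-distribʳ-sum)

-- Binomial coefficients and Leibniz's harmonic triangle

C-absorption : ∀ n k → suc k * (suc n C suc k) ≡ suc n * (n C k)
C-absorption zero    zero    = refl
C-absorption zero    (suc k) = *-zeroʳ (suc (suc k))
C-absorption (suc n) zero    = trans (*-identityˡ _) (trans (nC1≡n (suc (suc n))) (sym (*-identityʳ _)))
C-absorption (suc n) (suc k) = begin
  suc (suc k) * (suc (suc n) C suc (suc k))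
    ≡⟨ cong (suc (suc k) *_) (sym (nCk+nC[k+1]≡[n+1]C[k+1] (suc n) (suc k))) ⟩
  suc (suc k) * (suc n C suc k + suc n C suc (suc k))
    ≡⟨ regroup k (suc n C suc k) (suc n C suc (suc k)) ⟩
  suc n C suc k + suc k * (suc n C suc k) + suc (suc k) * (suc n C suc (suc k))
    ≡⟨ cong₂ (λ a b → suc n C suc k + a + b) (C-absorption n k) (C-absorption n (suc k)) ⟩
  suc n C suc k + suc n * (n C k) + suc n * (n C suc k)
    ≡⟨ regroup′ n (suc n C suc k) (n C k) (n C suc k) ⟩
  suc n C suc k + suc n * (n C k + n C suc k)
    ≡⟨ cong (λ a → suc n C suc k + suc n * a) (nCk+nC[k+1]≡[n+1]C[k+1] n k) ⟩
  suc (suc n) * (suc n C suc k) ∎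
  where
  open ≡-Reasoning
  regroup : ∀ k a b → suc (suc k) * (a + b) ≡ a + suc k * a + suc (suc k) * b
  regroup = solve-∀
  regroup′ : ∀ n a b c → a + suc n * b + suc n * c ≡ a + suc n * (b + c)
  regroup′ = solve-∀

C-mono-diagonal : ∀ n k → n C k ≤ suc n C suc k
C-mono-diagonal n k = ≤-trans (m≤m+n _ _) (≤-reflexive (nCk+nC[k+1]≡[n+1]C[k+1] n k))

C-positive : ∀ {n k} → k ≤ n → 0 < n C k
C-positive {k = zero}  _ = s≤s z≤n
C-positive {suc n} {suc k} (s≤s k≤n) = <-≤-trans (C-positive k≤n) (C-mono-diagonal n k)

C-monoˡ : ∀ n k → n C k ≤ suc n C k
C-monoˡ n zero    = ≤-refl
C-monoˡ n (suc k) = ≤-trans (m≤n+m _ (n C k)) (≤-reflexive (nCk+nC[k+1]≡[n+1]C[k+1] n k))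

2^m≤central-C : ∀ m → 2 ^ m ≤ (m + m) C m
2^m≤central-C zero    = ≤-refl
2^m≤central-C (suc m) = begin
  2 * 2 ^ m                                ≤⟨ *-monoʳ-≤ 2 (2^m≤central-C m) ⟩
  2 * c                                    ≡⟨ cong (c +_) (+-identityʳ c) ⟩
  c + c                                    ≤⟨ +-mono-≤ (C-monoˡ (m + m) m) (C-mono-diagonal (m + m) m) ⟩
  suc (m + m) C m + suc (m + m) C suc m    ≡⟨ nCk+nC[k+1]≡[n+1]C[k+1] (suc (m + m)) m ⟩
  suc (suc (m + m)) C suc m                ≡⟨ cong (λ a → suc a C suc m) (+-suc m m) ⟨
  (suc m + suc m) C suc m                  ∎
  where
  open ≤-Reasoning
  c : ℕ
  c = (m + m) C m

-- The denominators of Leibniz's harmonic triangle: 1/L(n,k) = 1/L(n+1,k) + 1/L(n+1,k+1).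
leibniz : ℕ → ℕ → ℕ
leibniz n k = suc n * (n C k)

leibniz-suc : ∀ n k → leibniz (suc n) k ≡ leibniz n k + suc k * (suc n C k)
leibniz-suc n zero    = arith n
  where
  arith : ∀ n → suc (suc n) * 1 ≡ suc n * 1 + 1 * 1
  arith = solve-∀
leibniz-suc n (suc k) = begin
  suc n C suc k + suc n * (suc n C suc k)
    ≡⟨ cong (λ a → suc n C suc k + suc n * a) (nCk+nC[k+1]≡[n+1]C[k+1] n k) ⟨
  suc n C suc k + suc n * (n C k + n C suc k)
    ≡⟨ regroup n (suc n C suc k) (n C k) (n C suc k) ⟩
  suc n * (n C suc k) + (suc n * (n C k) + suc n C suc k)
    ≡⟨ cong (λ a → suc n * (n C suc k) + (a + suc n C suc k)) (C-absorption n k) ⟨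
  suc n * (n C suc k) + (suc k * (suc n C suc k) + suc n C suc k)
    ≡⟨ cong (suc n * (n C suc k) +_) (+-comm (suc k * (suc n C suc k)) _) ⟩
  leibniz n (suc k) + suc (suc k) * (suc n C suc k) ∎
  where
  open ≡-Reasoning
  regroup : ∀ n a b c → a + suc n * (b + c) ≡ suc n * c + (suc n * b + a)
  regroup = solve-∀

leibniz-step : ∀ n k → leibniz (suc n) (suc k) * (suc k * (suc n C k)) ≡ leibniz n k * leibniz (suc n) k
leibniz-step n k = begin
  suc (suc n) * (suc n C suc k) * (suc k * (suc n C k)) ≡⟨ regroup (suc (suc n)) (suc n C suc k) (suc k) (suc n C k) ⟩
  suc k * (suc n C suc k) * leibniz (suc n) k           ≡⟨ cong (_* leibniz (suc n) k) (C-absorption n k) ⟩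
  leibniz n k * leibniz (suc n) k                       ∎
  where
  open ≡-Reasoning
  regroup : ∀ a b c d → a * b * (c * d) ≡ c * b * (a * d)
  regroup = solve-∀

-- 1/c = 1/a − 1/b, so M/c = M/a − M/b is again an integer.
∣-reciprocal-difference : ∀ {a b c e M} .{{_ : NonZero a}} .{{_ : NonZero e}} →
                          a ∣ M → b ∣ M → b ≡ a + e → c * e ≡ a * b → c ∣ M
∣-reciprocal-difference {a} {b} {c} {e} {M} (divides qa M≡qa*a) (divides qb M≡qb*b) b≡a+e ce≡ab =
  divides (qa ∸ qb) (*-cancelʳ-≡ M ((qa ∸ qb) * c) e (begin
    M * e                ≡⟨ cong (_* e) M≡qb*b ⟩
    qb * b * e           ≡⟨ *-comm-middle qb b e ⟩
    qb * e * b           ≡⟨ cong (_* b) [qa∸qb]*a≡qb*e ⟨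
    (qa ∸ qb) * a * b    ≡⟨ *-assoc (qa ∸ qb) a b ⟩
    (qa ∸ qb) * (a * b)  ≡⟨ cong ((qa ∸ qb) *_) ce≡ab ⟨
    (qa ∸ qb) * (c * e)  ≡⟨ *-assoc (qa ∸ qb) c e ⟨
    (qa ∸ qb) * c * e    ∎))
  where
  open ≡-Reasoning
  *-comm-middle : ∀ x y z → x * y * z ≡ x * z * y
  *-comm-middle = solve-∀
  qa*a≡qb*a+qb*e : qa * a ≡ qb * a + qb * e
  qa*a≡qb*a+qb*e = trans (sym M≡qa*a) (trans M≡qb*b (trans (cong (qb *_) b≡a+e) (*-distribˡ-+ qb a e)))
  [qa∸qb]*a≡qb*e : (qa ∸ qb) * a ≡ qb * e
  [qa∸qb]*a≡qb*e = begin
    (qa ∸ qb) * a             ≡⟨ *-distribʳ-∸ a qa qb ⟩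
    qa * a ∸ qb * a           ≡⟨ cong (_∸ qb * a) qa*a≡qb*a+qb*e ⟩
    qb * a + qb * e ∸ qb * a  ≡⟨ m+n∸m≡n (qb * a) (qb * e) ⟩
    qb * e                    ∎

leibniz-∣ : ∀ k n {M} → k ≤ n → (∀ {j} → 1 ≤ j → j ≤ suc n → j ∣ M) → leibniz n k ∣ M
leibniz-∣ zero    n {M}   _         all∣M = subst (_∣ M) (sym (*-identityʳ (suc n))) (all∣M (s≤s z≤n) ≤-refl)
leibniz-∣ (suc k) (suc n) (s≤s k≤n) all∣M =
  ∣-reciprocal-difference (leibniz-∣ k n k≤n (λ 1≤j j≤n → all∣M 1≤j (m≤n⇒m≤1+n j≤n)))
                          (leibniz-∣ k (suc n) (m≤n⇒m≤1+n k≤n) all∣M)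
                          (leibniz-suc n k) (leibniz-step n k)
  where
  instance
    leibniz≢0 : NonZero (leibniz n k)
    leibniz≢0 = >-nonZero (*-mono-≤ {1} {suc n} (s≤s z≤n) (C-positive k≤n))
    difference≢0 : NonZero (suc k * (suc n C k))
    difference≢0 = >-nonZero (*-mono-≤ {1} {suc k} (s≤s z≤n) (C-positive (m≤n⇒m≤1+n k≤n)))

2^m≤common-multiple : ∀ m {M} .{{_ : NonZero M}} → (∀ {j} → 1 ≤ j → j ≤ suc (m + m) → j ∣ M) → 2 ^ m ≤ M
2^m≤common-multiple m all∣M = begin
  2 ^ m              ≤⟨ 2^m≤central-C m ⟩
  (m + m) C m        ≤⟨ m≤n*m _ (suc (m + m)) ⟩
  leibniz (m + m) m  ≤⟨ ∣⇒≤ (leibniz-∣ m (m + m) (m≤n+m m m) all∣M) ⟩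
  _                  ∎
  where open ≤-Reasoning

-- Smooth numbers and a Chebyshev-type prime

prime⇒2≤ : ∀ {p} → Prime p → 2 ≤ p
prime⇒2≤ {p} p-prime = nonTrivial⇒n>1 p {{prime⇒nonTrivial p-prime}}

prime-divisor : ∀ {j} → 2 ≤ j → ∃[ p ] Prime p × p ∣ j
prime-divisor {j} 2≤j with factorise j {{>-nonZero (<-trans z<s 2≤j)}}
... | record { factors = [] ; isFactorisation = j≡1 } = contradiction j≡1 (>⇒≢ 2≤j)
... | record { factors = p ∷ ps ; isFactorisation = j≡p*ps ; factorsPrime = p-prime ∷ _ } =
  p , p-prime , divides (product ps) (trans j≡p*ps (*-comm p (product ps)))

^-monoʳ-∣ : ∀ q {a e} → a ≤ e → q ^ a ∣ q ^ e
^-monoʳ-∣ q {a} a≤e with m≤n⇒∃[o]m+o≡n a≤e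
... | d , refl = divides (q ^ d) (trans (^-distribˡ-+-* q a d) (*-comm (q ^ a) (q ^ d)))

power-bracket : ∀ q {N} → 2 ≤ q → 1 ≤ N → ∃[ e ] q ^ e ≤ N × N < q ^ suc e
power-bracket q {suc zero}    2≤q _ = 0 , ≤-refl , subst (1 <_) (sym (*-identityʳ q)) 2≤q
power-bracket q {suc (suc N)} 2≤q _ with power-bracket q 2≤q (s≤s (z≤n {N}))
... | e , q^e≤N , N<q^[1+e] with q ^ suc e ≤? suc (suc N)
...   | yes q^[1+e]≤N+1 = suc e , q^[1+e]≤N+1 , ≤-<-trans N<q^[1+e] (^-monoʳ-< q 2≤q (n<1+n (suc e)))
...   | no  q^[1+e]≰N+1 = e , m≤n⇒m≤1+n q^e≤N , ≰⇒> q^[1+e]≰N+1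

split-off-power : ∀ {q} → 2 ≤ q → ∀ j → 1 ≤ j → ∃₂ λ a r → j ≡ q ^ a * r × ¬ q ∣ r
split-off-power {q} 2≤q = <-rec _ split
  where
  split : ∀ j → (∀ {i} → i < j → 1 ≤ i → ∃₂ λ a r → i ≡ q ^ a * r × ¬ q ∣ r) →
          1 ≤ j → ∃₂ λ a r → j ≡ q ^ a * r × ¬ q ∣ r
  split j rec 1≤j with q ∣? j
  ... | no  q∤j = 0 , j , sym (+-identityʳ j) , q∤j
  ... | yes (divides i j≡i*q) with rec i<j 1≤i
    where
    1≤i : 1 ≤ i
    1≤i = n≢0⇒n>0 λ { refl → >⇒≢ 1≤j j≡i*q }
    i<j : i < j
    i<j = subst (i <_) (sym j≡i*q) (m<m*n i q {{>-nonZero 1≤i}} 2≤q)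
  ... | a , r , i≡q^a*r , q∤r = suc a , r , trans j≡i*q (trans (cong (_* q) i≡q^a*r) (regroup q (q ^ a) r)) , q∤r
    where
    regroup : ∀ q x r → x * r * q ≡ q * x * r
    regroup = solve-∀

Smooth : ℕ → ℕ → Set
Smooth y j = ∀ {p} → Prime p → p ∣ j → p ≤ y

smooth-common-multiple : ∀ N y → 1 ≤ N →
  ∃[ G ] 1 ≤ G × G ≤ N ^ y × (∀ {j} → 1 ≤ j → j ≤ N → Smooth y j → j ∣ G)
smooth-common-multiple N zero 1≤N = 1 , ≤-refl , ≤-refl , only-1
  where
  only-1 : ∀ {j} → 1 ≤ j → j ≤ N → Smooth 0 j → j ∣ 1
  only-1 {suc zero}    _ _ _       = ∣-refl
  only-1 {suc (suc j)} _ _ smooth with prime-divisor (s≤s (s≤s (z≤n {j})))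
  ... | p , p-prime , p∣j = contradiction (smooth p-prime p∣j) (<⇒≱ (<-trans z<s (prime⇒2≤ p-prime)))
smooth-common-multiple N (suc y) 1≤N with smooth-common-multiple N y 1≤N | prime? (suc y)
... | G , 1≤G , G≤N^y , smooth∣G | no ¬prime =
  G , 1≤G , ≤-trans G≤N^y (m≤n*m (N ^ y) N {{>-nonZero 1≤N}}) ,
  λ 1≤j j≤N smooth → smooth∣G 1≤j j≤N (λ p-prime p∣j →
    ≤-pred (≤∧≢⇒< (smooth p-prime p∣j) (λ { refl → ¬prime p-prime })))
... | G , 1≤G , G≤N^y , smooth∣G | yes q-prime with power-bracket (suc y) (prime⇒2≤ q-prime) 1≤N
...   | e , q^e≤N , N<q^[1+e] =
  q ^ e * G , *-mono-≤ (m^n>0 q e) 1≤G , *-mono-≤ q^e≤N G≤N^y , smooth∣q^eG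
  where
  q : ℕ
  q = suc y
  smooth∣q^eG : ∀ {j} → 1 ≤ j → j ≤ N → Smooth q j → j ∣ q ^ e * G
  smooth∣q^eG {j} 1≤j j≤N smooth with split-off-power (prime⇒2≤ q-prime) j 1≤j
  ... | a , r , j≡q^a*r , q∤r = subst (_∣ q ^ e * G) (sym j≡q^a*r) (*-pres-∣ (^-monoʳ-∣ q a≤e) (smooth∣G 1≤r r≤N smooth-r))
    where
    1≤r : 1 ≤ r
    1≤r = n≢0⇒n>0 λ { refl → >⇒≢ 1≤j (trans j≡q^a*r (*-zeroʳ (q ^ a))) }
    r≤N : r ≤ N
    r≤N = ≤-trans (subst (r ≤_) (sym j≡q^a*r) (m≤n*m r (q ^ a) {{m^n≢0 q a}})) j≤N
    smooth-r : Smooth y r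
    smooth-r p-prime p∣r = ≤-pred (≤∧≢⇒< (smooth p-prime (∣-trans p∣r (divides (q ^ a) j≡q^a*r)))
                                           (λ { refl → q∤r p∣r }))
    a≤e : a ≤ e
    a≤e = ^-cancelʳ-< (≤-<-trans (≤-trans (subst (q ^ a ≤_) (sym j≡q^a*r) (m≤m*n (q ^ a) r {{>-nonZero 1≤r}})) j≤N) N<q^[1+e])
      where
      ^-cancelʳ-< : q ^ a < q ^ suc e → a ≤ e
      ^-cancelʳ-< q^a<q^[1+e] with a ≤? e
      ... | yes a≤e = a≤e
      ... | no  a≰e = contradiction (^-monoʳ-≤ q (≰⇒> a≰e)) (<⇒≱ q^a<q^[1+e])

-- Otherwise every j ≤ 2m + 1 is y-smooth, so lcm(1, …, 2m + 1) ≥ 2^m divides some G ≤ (2m + 1)^y ≤ 2^(T y).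
prime-in-range : ∀ m T y → suc (m + m) ≤ 2 ^ T → T * y < m → ∃[ p ] Prime p × y < p × p ≤ suc (m + m)
prime-in-range m T y N≤2^T Ty<m with any? (λ (i : Fin (suc (suc (m + m)))) → prime? (toℕ i) ×-dec y <? toℕ i)
... | yes (i , i-prime , y<i) = toℕ i , i-prime , y<i , ≤-pred (toℕ<n i)
... | no  ∄p with smooth-common-multiple (suc (m + m)) y (s≤s z≤n)
...   | G , 1≤G , G≤N^y , smooth∣G = contradiction (^-monoʳ-< 2 ≤-refl Ty<m) (≤⇒≯ (begin
  2 ^ m                  ≤⟨ 2^m≤common-multiple m {{>-nonZero 1≤G}} (λ 1≤j j≤N → smooth∣G 1≤j j≤N (smooth 1≤j j≤N)) ⟩
  G                      ≤⟨ G≤N^y ⟩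
  suc (m + m) ^ y        ≤⟨ ^-monoˡ-≤ y N≤2^T ⟩
  (2 ^ T) ^ y            ≡⟨ ^-*-assoc 2 T y ⟩
  2 ^ (T * y)            ∎))
  where
  open ≤-Reasoning
  smooth : ∀ {j} → 1 ≤ j → j ≤ suc (m + m) → Smooth y j
  smooth 1≤j j≤N {p} p-prime p∣j with y <? p
  ... | no  y≮p = ≮⇒≥ y≮p
  ... | yes y<p = contradiction (fromℕ< p<N+1 , subst Prime (sym (toℕ-fromℕ< p<N+1)) p-prime ,
                                 subst (y <_) (sym (toℕ-fromℕ< p<N+1)) y<p) ∄p
    where
    p<N+1 : p < suc (suc (m + m))
    p<N+1 = s≤s (≤-trans (∣⇒≤ {{>-nonZero 1≤j}} p∣j) j≤N)

-- Finite sums and Iverson brackets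

∑-mono-≤ : ∀ {n} {f g : Fin n → ℕ} → (∀ i → f i ≤ g i) → ∑[ i < n ] f i ≤ ∑[ i < n ] g i
∑-mono-≤ {zero}  f≤g = z≤n
∑-mono-≤ {suc n} f≤g = +-mono-≤ (f≤g zero) (∑-mono-≤ (f≤g ∘ suc))

∑-const : ∀ n c → ∑[ i < n ] c ≡ n * c
∑-const zero    c = refl
∑-const (suc n) c = cong (c +_) (∑-const n c)

∑-product : ∀ {m n} (f : Fin m → ℕ) (g : Fin n → ℕ) → sum f * sum g ≡ ∑[ i < m ] ∑[ j < n ] (f i * g j)
∑-product f g = trans (*-distribʳ-sum (sum g) f) (sum-cong-≗ λ i → *-distribˡ-sum (f i) g)

2xy≤x²+y² : ∀ x y → 2 * x * y ≤ x * x + y * y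
2xy≤x²+y² x y with ≤-total x y
... | inj₁ x≤y with m≤n⇒∃[o]m+o≡n x≤y
...   | d , refl = ≤-trans (m≤m+n _ (d * d)) (≤-reflexive (expand x d))
  where
  expand : ∀ x d → 2 * x * (x + d) + d * d ≡ x * x + (x + d) * (x + d)
  expand = solve-∀
2xy≤x²+y² x y | inj₂ y≤x with m≤n⇒∃[o]m+o≡n y≤x
...   | d , refl = ≤-trans (m≤m+n _ (d * d)) (≤-reflexive (expand y d))
  where
  expand : ∀ y d → 2 * (y + d) * y + d * d ≡ (y + d) * (y + d) + y * y
  expand = solve-∀

-- 2 (∑ d)² = ∑ᵢ ∑ⱼ 2 dᵢ dⱼ ≤ ∑ᵢ ∑ⱼ (dᵢ² + dⱼ²) = 2 k ∑ d².
cauchy-schwarz : ∀ {k} (d : Fin k → ℕ) → sum d * sum d ≤ k * ∑[ i < k ] (d i * d i)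
cauchy-schwarz {k} d = *-cancelˡ-≤ 2 (begin
  2 * (sum d * sum d)                               ≡⟨ cong (2 *_) (∑-product d d) ⟩
  2 * ∑[ i < k ] ∑[ j < k ] (d i * d j)             ≡⟨ *-distribˡ-sum 2 (λ i → ∑[ j < k ] (d i * d j)) ⟩
  ∑[ i < k ] (2 * ∑[ j < k ] (d i * d j))           ≡⟨ sum-cong-≗ (λ i → *-distribˡ-sum 2 (λ j → d i * d j)) ⟩
  ∑[ i < k ] ∑[ j < k ] (2 * (d i * d j))           ≤⟨ ∑-mono-≤ (λ i → ∑-mono-≤ λ j →
                                                         ≤-trans (≤-reflexive (sym (*-assoc 2 (d i) (d j)))) (2xy≤x²+y² (d i) (d j))) ⟩
  ∑[ i < k ] ∑[ j < k ] (d i * d i + d j * d j)     ≡⟨ sum-cong-≗ (λ i → ∑-distrib-+ (λ _ → d i * d i) (λ j → d j * d j)) ⟩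
  ∑[ i < k ] (∑[ j < k ] (d i * d i) + Q)           ≡⟨ ∑-distrib-+ (λ i → ∑[ j < k ] (d i * d i)) (λ _ → Q) ⟩
  ∑[ i < k ] ∑[ j < k ] (d i * d i) + ∑[ i < k ] Q  ≡⟨ cong₂ _+_ (sum-cong-≗ λ i → ∑-const k (d i * d i)) (∑-const k Q) ⟩
  ∑[ i < k ] (k * (d i * d i)) + k * Q              ≡⟨ cong (_+ k * Q) (*-distribˡ-sum k (λ i → d i * d i)) ⟨
  k * Q + k * Q                                     ≡⟨ cong (k * Q +_) (+-identityʳ (k * Q)) ⟨
  2 * (k * Q)                                       ∎)
  where
  open ≤-Reasoning
  Q : ℕ
  Q = ∑[ i < k ] (d i * d i)

⟦_⟧ : ∀ {p} {P : Set p} → Dec P → ℕ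
⟦ P? ⟧ = if does P? then 1 else 0

⟦⟧≤1 : ∀ {p} {P : Set p} (P? : Dec P) → ⟦ P? ⟧ ≤ 1
⟦⟧≤1 (yes _) = ≤-refl
⟦⟧≤1 (no _)  = z≤n

⟦⟧-× : ∀ {p q} {P : Set p} {Q : Set q} (P? : Dec P) (Q? : Dec Q) → ⟦ P? ×-dec Q? ⟧ ≡ ⟦ P? ⟧ * ⟦ Q? ⟧
⟦⟧-× (yes _) (yes _) = refl
⟦⟧-× (yes _) (no _)  = refl
⟦⟧-× (no _)  _       = refl

⟦⟧+⟦¬⟧≡1 : ∀ {p} {P : Set p} (P? : Dec P) → ⟦ P? ⟧ + ⟦ ¬? P? ⟧ ≡ 1
⟦⟧+⟦¬⟧≡1 (yes _) = refl
⟦⟧+⟦¬⟧≡1 (no _)  = refl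

∑-⟦≟⟧* : ∀ {n} (j : Fin n) (g : Fin n → ℕ) → ∑[ i < n ] (⟦ j Fin.≟ i ⟧ * g i) ≡ g j
∑-⟦≟⟧* {suc n} zero    g = trans (cong₂ _+_ (*-identityˡ (g zero)) (trans (∑-const n 0) (*-zeroʳ n))) (+-identityʳ _)
∑-⟦≟⟧* {suc n} (suc j) g = ∑-⟦≟⟧* j (g ∘ suc)

∑-⟦≟⟧ : ∀ {n} (j : Fin n) → ∑[ i < n ] ⟦ j Fin.≟ i ⟧ ≡ 1
∑-⟦≟⟧ {n} j = trans (sum-cong-≗ {n} (λ i → sym (*-identityʳ ⟦ j Fin.≟ i ⟧))) (∑-⟦≟⟧* j (λ _ → 1))

⟦⟧-no : ∀ {p} {P : Set p} (P? : Dec P) → ¬ P → ⟦ P? ⟧ ≡ 0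
⟦⟧-no (yes P) ¬P = contradiction P ¬P
⟦⟧-no (no _)  _  = refl

∑-⟦⟧≤1 : ∀ {n p} {P : Pred (Fin n) p} (P? : Decidable P) → (∀ {v w} → P v → P w → v ≡ w) → ∑[ v < n ] ⟦ P? v ⟧ ≤ 1
∑-⟦⟧≤1 {zero}  P? unique = z≤n
∑-⟦⟧≤1 {suc n} P? unique with P? zero
... | yes P0 = s≤s (≤-reflexive (trans (sum-cong-≗ {n} λ v → ⟦⟧-no (P? (suc v)) λ Pv → Fin.0≢1+n (unique P0 Pv))
                                       (sum-replicate-zero n)))
... | no  _  = ∑-⟦⟧≤1 (P? ∘ suc) (λ Pv Pw → Fin.suc-injective (unique Pv Pw))

∑-⟦⟧≤-injective : ∀ {n k p} {P : Pred (Fin n) p} (P? : Decidable P) (f : Fin n → Fin k) →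
                  (∀ {v w} → P v → P w → f v ≡ f w → v ≡ w) → ∑[ v < n ] ⟦ P? v ⟧ ≤ k
∑-⟦⟧≤-injective {n} {k} P? f injective = begin
  ∑[ v < n ] ⟦ P? v ⟧
    ≡⟨ sum-cong-≗ {n} (λ v → sym (trans (cong (⟦ P? v ⟧ *_) (∑-⟦≟⟧ (f v))) (*-identityʳ _))) ⟩
  ∑[ v < n ] (⟦ P? v ⟧ * ∑[ i < k ] ⟦ f v Fin.≟ i ⟧)
    ≡⟨ sum-cong-≗ {n} (λ v → *-distribˡ-sum ⟦ P? v ⟧ (λ i → ⟦ f v Fin.≟ i ⟧)) ⟩
  ∑[ v < n ] ∑[ i < k ] (⟦ P? v ⟧ * ⟦ f v Fin.≟ i ⟧)
    ≡⟨ sum-cong-≗ {n} (λ v → sum-cong-≗ {k} λ i → ⟦⟧-× (P? v) (f v Fin.≟ i)) ⟨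
  ∑[ v < n ] ∑[ i < k ] ⟦ P? v ×-dec f v Fin.≟ i ⟧
    ≡⟨ ∑-comm (λ v i → ⟦ P? v ×-dec f v Fin.≟ i ⟧) ⟩
  ∑[ i < k ] ∑[ v < n ] ⟦ P? v ×-dec f v Fin.≟ i ⟧
    ≤⟨ ∑-mono-≤ (λ i → ∑-⟦⟧≤1 (λ v → P? v ×-dec f v Fin.≟ i)
        λ (Pv , fv≡i) (Pw , fw≡i) → injective Pv Pw (trans fv≡i (sym fw≡i))) ⟩
  ∑[ i < k ] 1
    ≡⟨ trans (∑-const k 1) (*-identityʳ k) ⟩
  k ∎
  where open ≤-Reasoning

-- The lower bound: counting monochromatic wedges

same-side : ∀ {a b c : Bool} → a ≢ c → b ≢ c → a ≡ b
same-side a≢c b≢c = trans (¬-not a≢c) (sym (¬-not b≢c))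

module DoubleCounting {n k} (c : EdgeColouring n k) (partition : IsC4AvoidingBipartitePartition c) where

  private
    c-sym : Symmetric c
    c-sym = proj₁ partition
    no-induced-C4 : ∀ i → HasInducedC4 c i → ⊥
    no-induced-C4 = proj₂ (proj₂ partition)
    side : Fin k → Fin n → Bool
    side i = proj₁ (proj₁ (proj₂ partition) i)
    side-proper : ∀ {i} u v → u ≢ v → c u v ≡ i → side i u ≢ side i v
    side-proper {i} = proj₂ (proj₁ (proj₂ partition) i)

  -- If v ≠ w then v x w y is a 4-cycle in the part of c v x; bipartiteness puts v, w on one side
  -- and x, y on the other, so neither diagonal lies in the part and the cycle is induced.
  monochromatic-wedge-unique : ∀ {x y v w} → x ≢ y → v ≢ x → v ≢ y → w ≢ x → w ≢ y →
                               c v y ≡ c v x → c w y ≡ c w x → c v x ≡ c w x → v ≡ w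
  monochromatic-wedge-unique {x} {y} {v} {w} x≢y v≢x v≢y w≢x w≢y cvy≡cvx cwy≡cwx cvx≡cwx with v Fin.≟ w
  ... | yes v≡w = v≡w
  ... | no  v≢w = ⊥-elim (no-induced-C4 j (v , x , w , y , (v≢x , v≢w , v≢y , ≢-sym w≢x , x≢y , w≢y) ,
                                   (refl , cxw≡j , cwy≡j , cyv≡j) , v≁w , x≁y))
    where
    j : Fin k
    j = c v x
    cxw≡j : c x w ≡ j
    cxw≡j = trans (c-sym x w (≢-sym w≢x)) (sym cvx≡cwx)
    cwy≡j : c w y ≡ j
    cwy≡j = trans cwy≡cwx (sym cvx≡cwx)
    cyv≡j : c y v ≡ j
    cyv≡j = trans (c-sym y v (≢-sym v≢y)) cvy≡cvx
    v≁w : c v w ≢ j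
    v≁w cvw≡j = side-proper v w v≢w cvw≡j
                  (same-side (side-proper v x v≢x refl) (side-proper w x w≢x (trans (c-sym w x w≢x) cxw≡j)))
    x≁y : c x y ≢ j
    x≁y cxy≡j = side-proper x y x≢y cxy≡j
                  (same-side (side-proper x v (≢-sym v≢x) (c-sym x v (≢-sym v≢x))) (side-proper y v (≢-sym v≢y) cyv≡j))

  Wedge : Fin n → Fin n → Fin n → Set
  Wedge v x y = v ≢ x × v ≢ y × c v y ≡ c v x

  wedge? : ∀ v x y → Dec (Wedge v x y)
  wedge? v x y = ¬? (v Fin.≟ x) ×-dec ¬? (v Fin.≟ y) ×-dec c v y Fin.≟ c v x

  neighbour? : ∀ v i x → Dec (v ≢ x × c v x ≡ i)
  neighbour? v i x = ¬? (v Fin.≟ x) ×-dec c v x Fin.≟ i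

  degree : Fin n → Fin k → ℕ
  degree v i = ∑[ x < n ] ⟦ neighbour? v i x ⟧

  ∑-degree : ∀ v → ∑[ i < k ] degree v i + 1 ≡ n
  ∑-degree v = begin
    ∑[ i < k ] degree v i + 1
      ≡⟨ cong₂ _+_ (∑-comm (λ i x → ⟦ neighbour? v i x ⟧)) (sym (∑-⟦≟⟧ v)) ⟩
    ∑[ x < n ] ∑[ i < k ] ⟦ neighbour? v i x ⟧ + ∑[ x < n ] ⟦ v Fin.≟ x ⟧
      ≡⟨ cong (_+ ∑[ x < n ] ⟦ v Fin.≟ x ⟧) (sum-cong-≗ {n} single-colour) ⟩
    ∑[ x < n ] ⟦ ¬? (v Fin.≟ x) ⟧ + ∑[ x < n ] ⟦ v Fin.≟ x ⟧
      ≡⟨ ∑-distrib-+ (λ x → ⟦ ¬? (v Fin.≟ x) ⟧) (λ x → ⟦ v Fin.≟ x ⟧) ⟨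
    ∑[ x < n ] (⟦ ¬? (v Fin.≟ x) ⟧ + ⟦ v Fin.≟ x ⟧)
      ≡⟨ sum-cong-≗ {n} (λ x → trans (+-comm ⟦ ¬? (v Fin.≟ x) ⟧ ⟦ v Fin.≟ x ⟧) (⟦⟧+⟦¬⟧≡1 (v Fin.≟ x))) ⟩
    ∑[ x < n ] 1
      ≡⟨ trans (∑-const n 1) (*-identityʳ n) ⟩
    n ∎
    where
    open ≡-Reasoning
    single-colour : ∀ x → ∑[ i < k ] ⟦ neighbour? v i x ⟧ ≡ ⟦ ¬? (v Fin.≟ x) ⟧
    single-colour x = begin
      ∑[ i < k ] ⟦ neighbour? v i x ⟧
        ≡⟨ sum-cong-≗ {k} (λ i → ⟦⟧-× (¬? (v Fin.≟ x)) (c v x Fin.≟ i)) ⟩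
      ∑[ i < k ] (⟦ ¬? (v Fin.≟ x) ⟧ * ⟦ c v x Fin.≟ i ⟧)
        ≡⟨ *-distribˡ-sum ⟦ ¬? (v Fin.≟ x) ⟧ (λ i → ⟦ c v x Fin.≟ i ⟧) ⟨
      ⟦ ¬? (v Fin.≟ x) ⟧ * ∑[ i < k ] ⟦ c v x Fin.≟ i ⟧
        ≡⟨ cong (⟦ ¬? (v Fin.≟ x) ⟧ *_) (∑-⟦≟⟧ (c v x)) ⟩
      ⟦ ¬? (v Fin.≟ x) ⟧ * 1
        ≡⟨ *-identityʳ _ ⟩
      ⟦ ¬? (v Fin.≟ x) ⟧ ∎

  ∑-degree² : ∀ v → ∑[ i < k ] (degree v i * degree v i) ≡ ∑[ x < n ] ∑[ y < n ] ⟦ wedge? v x y ⟧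
  ∑-degree² v = begin
    ∑[ i < k ] (degree v i * degree v i)
      ≡⟨ sum-cong-≗ {k} (λ i → ∑-product (N i) (N i)) ⟩
    ∑[ i < k ] ∑[ x < n ] ∑[ y < n ] (N i x * N i y)
      ≡⟨ ∑-comm (λ i x → ∑[ y < n ] (N i x * N i y)) ⟩
    ∑[ x < n ] ∑[ i < k ] ∑[ y < n ] (N i x * N i y)
      ≡⟨ sum-cong-≗ {n} (λ x → ∑-comm (λ i y → N i x * N i y)) ⟩
    ∑[ x < n ] ∑[ y < n ] ∑[ i < k ] (N i x * N i y)
      ≡⟨ sum-cong-≗ {n} (λ x → sum-cong-≗ {n} (λ y → wedge-indicator x y)) ⟩
    ∑[ x < n ] ∑[ y < n ] ⟦ wedge? v x y ⟧ ∎
    where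
    open ≡-Reasoning
    N : Fin k → Fin n → ℕ
    N i x = ⟦ neighbour? v i x ⟧
    regroup : ∀ a b a′ b′ → a * b * (a′ * b′) ≡ a * a′ * (b * b′)
    regroup = solve-∀
    wedge-indicator : ∀ x y → ∑[ i < k ] (N i x * N i y) ≡ ⟦ wedge? v x y ⟧
    wedge-indicator x y = begin
      ∑[ i < k ] (N i x * N i y)
        ≡⟨ sum-cong-≗ {k} (λ i → trans (cong₂ _*_ (⟦⟧-× (¬? (v Fin.≟ x)) (c v x Fin.≟ i))
                                                   (⟦⟧-× (¬? (v Fin.≟ y)) (c v y Fin.≟ i)))
                                         (regroup a ⟦ c v x Fin.≟ i ⟧ b ⟦ c v y Fin.≟ i ⟧)) ⟩
      ∑[ i < k ] (a * b * (⟦ c v x Fin.≟ i ⟧ * ⟦ c v y Fin.≟ i ⟧))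
        ≡⟨ *-distribˡ-sum (a * b) (λ i → ⟦ c v x Fin.≟ i ⟧ * ⟦ c v y Fin.≟ i ⟧) ⟨
      a * b * ∑[ i < k ] (⟦ c v x Fin.≟ i ⟧ * ⟦ c v y Fin.≟ i ⟧)
        ≡⟨ cong (a * b *_) (∑-⟦≟⟧* (c v x) (λ i → ⟦ c v y Fin.≟ i ⟧)) ⟩
      a * b * ⟦ c v y Fin.≟ c v x ⟧
        ≡⟨ *-assoc a b _ ⟩
      a * (b * ⟦ c v y Fin.≟ c v x ⟧)
        ≡⟨ trans (⟦⟧-× (¬? (v Fin.≟ x)) (¬? (v Fin.≟ y) ×-dec c v y Fin.≟ c v x))
                 (cong (a *_) (⟦⟧-× (¬? (v Fin.≟ y)) (c v y Fin.≟ c v x))) ⟨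
      ⟦ wedge? v x y ⟧ ∎
      where
      a b : ℕ
      a = ⟦ ¬? (v Fin.≟ x) ⟧
      b = ⟦ ¬? (v Fin.≟ y) ⟧

  ∑-wedge≤ : ∀ x y → ∑[ v < n ] ⟦ wedge? v x y ⟧ ≤ k + n * ⟦ x Fin.≟ y ⟧
  ∑-wedge≤ x y with x Fin.≟ y
  ... | yes _   = ≤-trans (∑-mono-≤ (λ v → ⟦⟧≤1 (wedge? v x y))) (≤-trans (≤-reflexive (∑-const n 1)) (m≤n+m (n * 1) k))
  ... | no  x≢y = ≤-trans (∑-⟦⟧≤-injective (λ v → wedge? v x y) (λ v → c v x) unique) (m≤m+n k (n * 0))
    where
    unique : ∀ {v w} → Wedge v x y → Wedge w x y → c v x ≡ c w x → v ≡ w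
    unique (v≢x , v≢y , cvy≡cvx) (w≢x , w≢y , cwy≡cwx) = monochromatic-wedge-unique x≢y v≢x v≢y w≢x w≢y cvy≡cvx cwy≡cwx

  wedge-count : ∀ {t} → n ≡ suc t → n * (t * t) ≤ k * (n * (n * k + n))
  wedge-count {t} n≡1+t = begin
    n * (t * t)
      ≡⟨ ∑-const n (t * t) ⟨
    ∑[ v < n ] (t * t)
      ≡⟨ sum-cong-≗ {n} (λ v → cong (λ a → a * a) (∑-degree≡t v)) ⟨
    ∑[ v < n ] (∑[ i < k ] degree v i * ∑[ i < k ] degree v i)
      ≤⟨ ∑-mono-≤ (λ v → cauchy-schwarz (degree v)) ⟩
    ∑[ v < n ] (k * ∑[ i < k ] (degree v i * degree v i))
      ≡⟨ *-distribˡ-sum k (λ v → ∑[ i < k ] (degree v i * degree v i)) ⟨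
    k * ∑[ v < n ] ∑[ i < k ] (degree v i * degree v i)
      ≡⟨ cong (k *_) (sum-cong-≗ {n} ∑-degree²) ⟩
    k * ∑[ v < n ] ∑[ x < n ] ∑[ y < n ] W v x y
      ≡⟨ cong (k *_) (∑-comm (λ v x → ∑[ y < n ] W v x y)) ⟩
    k * ∑[ x < n ] ∑[ v < n ] ∑[ y < n ] W v x y
      ≡⟨ cong (k *_) (sum-cong-≗ {n} λ x → ∑-comm (λ v y → W v x y)) ⟩
    k * ∑[ x < n ] ∑[ y < n ] ∑[ v < n ] W v x y
      ≤⟨ *-monoʳ-≤ k (∑-mono-≤ λ x → ∑-mono-≤ λ y → ∑-wedge≤ x y) ⟩
    k * ∑[ x < n ] ∑[ y < n ] (k + n * ⟦ x Fin.≟ y ⟧)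
      ≡⟨ cong (k *_) (sum-cong-≗ {n} row) ⟩
    k * ∑[ x < n ] (n * k + n)
      ≡⟨ cong (k *_) (∑-const n (n * k + n)) ⟩
    k * (n * (n * k + n)) ∎
    where
    open ≤-Reasoning
    W : Fin n → Fin n → Fin n → ℕ
    W v x y = ⟦ wedge? v x y ⟧
    ∑-degree≡t : ∀ v → ∑[ i < k ] degree v i ≡ t
    ∑-degree≡t v = +-cancelʳ-≡ 1 _ t (trans (∑-degree v) (trans n≡1+t (+-comm 1 t)))
    row : ∀ x → ∑[ y < n ] (k + n * ⟦ x Fin.≟ y ⟧) ≡ n * k + n
    row x = begin-equality
      ∑[ y < n ] (k + n * ⟦ x Fin.≟ y ⟧)             ≡⟨ ∑-distrib-+ (λ _ → k) (λ y → n * ⟦ x Fin.≟ y ⟧) ⟩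
      ∑[ y < n ] k + ∑[ y < n ] (n * ⟦ x Fin.≟ y ⟧)  ≡⟨ cong₂ _+_ (∑-const n k) (sym (*-distribˡ-sum n (λ y → ⟦ x Fin.≟ y ⟧))) ⟩
      n * k + n * ∑[ y < n ] ⟦ x Fin.≟ y ⟧           ≡⟨ cong (λ a → n * k + n * a) (∑-⟦≟⟧ x) ⟩
      n * k + n * 1                                  ≡⟨ cong (n * k +_) (*-identityʳ n) ⟩
      n * k + n                                      ∎

t²≤k[nk+n]⇒n≤9k² : ∀ {t k} → 1 ≤ t → t * t ≤ k * (suc t * k + suc t) → suc t ≤ 3 * 3 * (k * k)
t²≤k[nk+n]⇒n≤9k² {t} {zero}  1≤t t²≤0 = contradiction t²≤0 (<⇒≱ (*-mono-≤ 1≤t 1≤t))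
t²≤k[nk+n]⇒n≤9k² {t} {suc k} 1≤t t²≤ = begin
  suc t           ≡⟨ +-comm 1 t ⟩
  t + 1           ≤⟨ +-mono-≤ t≤4K² (*-mono-≤ 1≤K 1≤K) ⟩
  4 * K² + K²     ≤⟨ ≤-trans (≤-reflexive (five K²)) (*-monoˡ-≤ K² {5} {9} (s≤s (s≤s (s≤s (s≤s (s≤s z≤n)))))) ⟩
  3 * 3 * K²      ∎
  where
  open ≤-Reasoning
  K K² : ℕ
  K = suc k
  K² = K * K
  1≤K : 1 ≤ K
  1≤K = s≤s z≤n
  five : ∀ a → 4 * a + a ≡ 5 * a
  five = solve-∀
  expand : ∀ t K → K * (suc t * K + suc t) ≡ suc t * (K * K + K)
  expand = solve-∀
  collect : ∀ t a → (t + t) * (a + a) ≡ t * (4 * a)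
  collect = solve-∀
  t≤4K² : t ≤ 4 * K²
  t≤4K² = *-cancelˡ-≤ t {{>-nonZero 1≤t}} (begin
    t * t                    ≤⟨ t²≤ ⟩
    K * (suc t * K + suc t)  ≡⟨ expand t K ⟩
    suc t * (K² + K)         ≤⟨ *-mono-≤ (+-monoˡ-≤ t 1≤t) (+-monoʳ-≤ K² (m≤m*n K K)) ⟩
    (t + t) * (K² + K²)      ≡⟨ collect t K² ⟩
    t * (4 * K²)             ∎)

lower-bound : ∀ {n k} → 2 ≤ n → HasPartition n k → n ≤ 3 * 3 * (k * k)
lower-bound {suc t} {k} (s≤s 1≤t) (c , partition) =
  t²≤k[nk+n]⇒n≤9k² {t} {k} 1≤t (*-cancelˡ-≤ (suc t) (≤-trans (wedge-count refl) (≤-reflexive (swap k (suc t) (suc t * k + suc t)))))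
  where
  open DoubleCounting c partition
  swap : ∀ a b x → a * (b * x) ≡ b * (a * x)
  swap = solve-∀

-- Arithmetic modulo a prime

%-≡⇒∣ : ∀ m d p .{{_ : NonZero p}} → (m + d) % p ≡ m % p → p ∣ d
%-≡⇒∣ m d p eq = ∣m+n∣m⇒∣n (divides ((m + d) / p) (+-cancelˡ-≡ (m % p) _ _ (begin
  m % p + (m / p * p + d)        ≡⟨ +-assoc (m % p) _ d ⟨
  m % p + m / p * p + d          ≡⟨ cong (_+ d) (m≡m%n+[m/n]*n m p) ⟨
  m + d                          ≡⟨ m≡m%n+[m/n]*n (m + d) p ⟩
  (m + d) % p + (m + d) / p * p  ≡⟨ cong (_+ (m + d) / p * p) eq ⟩
  m % p + (m + d) / p * p        ∎))) (n∣m*n (m / p))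
  where open ≡-Reasoning

∣∧<⇒≡0 : ∀ {p d} → p ∣ d → d < p → d ≡ 0
∣∧<⇒≡0 {d = zero}  _   _   = refl
∣∧<⇒≡0 {d = suc d} p∣d d<p = contradiction (∣⇒≤ p∣d) (<⇒≱ d<p)

%-cancelʳ-+-≤ : ∀ {a b} c p .{{_ : NonZero p}} → a ≤ b → b < p → (a + c) % p ≡ (b + c) % p → a ≡ b
%-cancelʳ-+-≤ {a} c p a≤b b<p eq with m≤n⇒∃[o]m+o≡n a≤b
... | d , refl = sym (trans (cong (a +_) d≡0) (+-identityʳ a))
  where
  +-comm-right : ∀ a c d → a + c + d ≡ a + d + c
  +-comm-right = solve-∀
  d≡0 : d ≡ 0
  d≡0 = ∣∧<⇒≡0 (%-≡⇒∣ (a + c) d p (trans (cong (_% p) (+-comm-right a c d)) (sym eq))) (≤-<-trans (m≤n+m d a) b<p)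

%-cancelʳ-+ : ∀ {a b} c p .{{_ : NonZero p}} → a < p → b < p → (a + c) % p ≡ (b + c) % p → a ≡ b
%-cancelʳ-+ {a} {b} c p a<p b<p eq with ≤-total a b
... | inj₁ a≤b = %-cancelʳ-+-≤ c p a≤b b<p eq
... | inj₂ b≤a = sym (%-cancelʳ-+-≤ c p b≤a a<p (sym eq))

module PrimeModulus {p} (p-prime : Prime p) where

  private instance
    p≢0 : NonZero p
    p≢0 = prime⇒nonZero p-prime

  CrossTerms : ℕ → ℕ → ℕ → ℕ → ℕ → Set
  CrossTerms c x₁ x₂ X₁ X₂ = (c + (x₁ * X₁ + x₂ * X₂)) % p ≡ (c + (x₁ * X₂ + x₂ * X₁)) % p

  -- x₁ X₁ + x₂ X₂ − (x₁ X₂ + x₂ X₁) = (x₂ − x₁)(X₂ − X₁), and p is prime.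
  cross-terms-≤ : ∀ c {x₁ x₂ X₁ X₂} → x₁ ≤ x₂ → X₁ ≤ X₂ → x₂ < p → X₂ < p →
                  CrossTerms c x₁ x₂ X₁ X₂ → x₁ ≡ x₂ ⊎ X₁ ≡ X₂
  cross-terms-≤ c {x₁} {X₁ = X₁} x₁≤x₂ X₁≤X₂ x₂<p X₂<p eq
    with m≤n⇒∃[o]m+o≡n x₁≤x₂ | m≤n⇒∃[o]m+o≡n X₁≤X₂
  ... | d , refl | e , refl =
    ⊎-map (λ d≡0 → sym (trans (cong (x₁ +_) d≡0) (+-identityʳ x₁)))
          (λ e≡0 → sym (trans (cong (X₁ +_) e≡0) (+-identityʳ X₁)))
          (⊎-map (λ p∣d → ∣∧<⇒≡0 p∣d (≤-<-trans (m≤n+m d x₁) x₂<p))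
                 (λ p∣e → ∣∧<⇒≡0 p∣e (≤-<-trans (m≤n+m e X₁) X₂<p))
                 (euclidsLemma d e p-prime p∣de))
    where
    expand : ∀ c x X d e → c + (x * X + (x + d) * (X + e)) ≡ c + (x * (X + e) + (x + d) * X) + d * e
    expand = solve-∀
    p∣de : p ∣ d * e
    p∣de = %-≡⇒∣ (c + (x₁ * (X₁ + e) + (x₁ + d) * X₁)) (d * e) p (trans (cong (_% p) (sym (expand c x₁ X₁ d e))) eq)

  cross-terms : ∀ c {x₁ x₂ X₁ X₂} → x₁ < p → x₂ < p → X₁ < p → X₂ < p →
                CrossTerms c x₁ x₂ X₁ X₂ → x₁ ≡ x₂ ⊎ X₁ ≡ X₂
  cross-terms c {x₁} {x₂} {X₁} {X₂} x₁<p x₂<p X₁<p X₂<p eq = cases (≤-total x₁ x₂) (≤-total X₁ X₂)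
    where
    swapped : CrossTerms c x₂ x₁ X₁ X₂
    swapped = trans (cong (λ t → (c + t) % p) (+-comm (x₂ * X₁) (x₁ * X₂)))
                    (trans (sym eq) (cong (λ t → (c + t) % p) (+-comm (x₁ * X₁) (x₂ * X₂))))
    cases : x₁ ≤ x₂ ⊎ x₂ ≤ x₁ → X₁ ≤ X₂ ⊎ X₂ ≤ X₁ → x₁ ≡ x₂ ⊎ X₁ ≡ X₂
    cases (inj₁ x₁≤x₂) (inj₁ X₁≤X₂) = cross-terms-≤ c x₁≤x₂ X₁≤X₂ x₂<p X₂<p eq
    cases (inj₁ x₁≤x₂) (inj₂ X₂≤X₁) = ⊎-map id sym (cross-terms-≤ c x₁≤x₂ X₂≤X₁ x₂<p X₁<p (sym eq))
    cases (inj₂ x₂≤x₁) (inj₁ X₁≤X₂) = ⊎-map sym id (cross-terms-≤ c x₂≤x₁ X₁≤X₂ x₁<p X₂<p swapped)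
    cases (inj₂ x₂≤x₁) (inj₂ X₂≤X₁) = ⊎-map sym sym (cross-terms-≤ c x₂≤x₁ X₂≤X₁ x₁<p X₁<p (sym swapped))

  low mid block : ℕ → ℕ
  low z = z % p
  mid z = z / p % p
  block z = z / p / p

  coordinates-injective : ∀ {u v} → low u ≡ low v → mid u ≡ mid v → block u ≡ block v → u ≡ v
  coordinates-injective {u} {v} lu≡lv mu≡mv bu≡bv = begin
    u                                  ≡⟨ expansion u ⟩
    low u + (mid u + block u * p) * p  ≡⟨ cong₂ (λ l m → l + m * p) lu≡lv (cong₂ (λ m b → m + b * p) mu≡mv bu≡bv) ⟩
    low v + (mid v + block v * p) * p  ≡⟨ expansion v ⟨
    v                                  ∎
    where
    open ≡-Reasoning
    expansion : ∀ z → z ≡ low z + (mid z + block z * p) * p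
    expansion z = trans (m≡m%n+[m/n]*n z p) (cong (λ t → low z + t * p) (m≡m%n+[m/n]*n (z / p) p))

  quadratic : ℕ → ℕ → ℕ
  quadratic l r = (low l + low r + mid l * mid r) % p

  quadratic-comm : ∀ l r → quadratic l r ≡ quadratic r l
  quadratic-comm l r = cong (_% p) (swap (low l) (low r) (mid l) (mid r))
    where
    swap : ∀ a b x y → a + b + x * y ≡ b + a + y * x
    swap = solve-∀

  quadratic-injectiveˡ : ∀ {l₁ l₂ r} → mid l₁ ≡ mid l₂ → quadratic l₁ r ≡ quadratic l₂ r → low l₁ ≡ low l₂
  quadratic-injectiveˡ {l₁} {l₂} {r} ml₁≡ml₂ eq = %-cancelʳ-+ (low r + mid l₂ * mid r) p (m%n<n l₁ p) (m%n<n l₂ p) (begin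
    (low l₁ + (low r + mid l₂ * mid r)) % p  ≡⟨ cong (λ m → (low l₁ + (low r + m * mid r)) % p) ml₁≡ml₂ ⟨
    (low l₁ + (low r + mid l₁ * mid r)) % p  ≡⟨ cong (_% p) (+-assoc (low l₁) (low r) _) ⟨
    quadratic l₁ r                           ≡⟨ eq ⟩
    quadratic l₂ r                           ≡⟨ cong (_% p) (+-assoc (low l₂) (low r) _) ⟩
    (low l₂ + (low r + mid l₂ * mid r)) % p  ∎)
    where open ≡-Reasoning

  quadratic-cross-terms : ∀ {l₁ l₂ r₁ r₂} → quadratic l₁ r₁ ≡ quadratic l₂ r₁ → quadratic l₁ r₂ ≡ quadratic l₂ r₂ →
                          CrossTerms (low l₁ + low r₁ + (low l₂ + low r₂)) (mid l₁) (mid l₂) (mid r₁) (mid r₂)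
  quadratic-cross-terms {l₁} {l₂} {r₁} {r₂} eq₁ eq₂ = begin
    (c + (mid l₁ * mid r₁ + mid l₂ * mid r₂)) % p
      ≡⟨ cong (_% p) (diagonal (low l₁) (low r₁) (low l₂) (low r₂) (mid l₁) (mid l₂) (mid r₁) (mid r₂)) ⟩
    (A₁₁ + A₂₂) % p
      ≡⟨ %-distribˡ-+ A₁₁ A₂₂ p ⟩
    (A₁₁ % p + A₂₂ % p) % p
      ≡⟨ cong₂ (λ a b → (a + b) % p) eq₁ (sym eq₂) ⟩
    (A₂₁ % p + A₁₂ % p) % p
      ≡⟨ %-distribˡ-+ A₂₁ A₁₂ p ⟨
    (A₂₁ + A₁₂) % p
      ≡⟨ cong (_% p) (antidiagonal (low l₁) (low r₁) (low l₂) (low r₂) (mid l₁) (mid l₂) (mid r₁) (mid r₂)) ⟨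
    (c + (mid l₁ * mid r₂ + mid l₂ * mid r₁)) % p ∎
    where
    open ≡-Reasoning
    c A₁₁ A₁₂ A₂₁ A₂₂ : ℕ
    c = low l₁ + low r₁ + (low l₂ + low r₂)
    A₁₁ = low l₁ + low r₁ + mid l₁ * mid r₁
    A₁₂ = low l₁ + low r₂ + mid l₁ * mid r₂
    A₂₁ = low l₂ + low r₁ + mid l₂ * mid r₁
    A₂₂ = low l₂ + low r₂ + mid l₂ * mid r₂
    diagonal : ∀ a b a′ b′ x x′ X X′ → a + b + (a′ + b′) + (x * X + x′ * X′) ≡ (a + b + x * X) + (a′ + b′ + x′ * X′)
    diagonal = solve-∀
    antidiagonal : ∀ a b a′ b′ x x′ X X′ → a + b + (a′ + b′) + (x * X′ + x′ * X) ≡ (a′ + b + x′ * X) + (a + b′ + x * X′)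
    antidiagonal = solve-∀

  quadratic-rectangle : ∀ {l₁ l₂ r₁ r₂} → block l₁ ≡ block l₂ → block r₁ ≡ block r₂ →
                        quadratic l₁ r₁ ≡ quadratic l₂ r₁ → quadratic l₁ r₂ ≡ quadratic l₂ r₂ →
                        quadratic l₁ r₁ ≡ quadratic l₁ r₂ → l₁ ≡ l₂ ⊎ r₁ ≡ r₂
  quadratic-rectangle {l₁} {l₂} {r₁} {r₂} bl₁≡bl₂ br₁≡br₂ eq₁ eq₂ eq₃ with mid l₁ ≟ mid l₂ | mid r₁ ≟ mid r₂
  ... | yes ml₁≡ml₂ | _ = inj₁ (coordinates-injective (quadratic-injectiveˡ ml₁≡ml₂ eq₁) ml₁≡ml₂ bl₁≡bl₂)
  ... | no _ | yes mr₁≡mr₂ =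
    inj₂ (coordinates-injective (quadratic-injectiveˡ mr₁≡mr₂ (trans (quadratic-comm r₁ l₁) (trans eq₃ (quadratic-comm l₁ r₂))))
                                mr₁≡mr₂ br₁≡br₂)
  ... | no ml₁≢ml₂ | no mr₁≢mr₂ = ⊥-elim ([ ml₁≢ml₂ , mr₁≢mr₂ ]
    (cross-terms (low l₁ + low r₁ + (low l₂ + low r₂)) (m%n<n (l₁ / p) p) (m%n<n (l₂ / p) p) (m%n<n (r₁ / p) p) (m%n<n (r₂ / p) p)
                 (quadratic-cross-terms eq₁ eq₂)))

-- Bits and the block tagging

bit : ℕ → ℕ → Bool
bit zero    z = z % 2 ≡ᵇ 1
bit (suc j) z = bit j (z / 2)

-- Only the t lowest bits are inspected; the result is t when they all agree.
lowest-differing-bit : ℕ → ℕ → ℕ → ℕ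
lowest-differing-bit zero    u v = zero
lowest-differing-bit (suc t) u v with bit 0 u Bool.≟ bit 0 v
... | yes _ = suc (lowest-differing-bit t (u / 2) (v / 2))
... | no  _ = zero

lowest-differing-bit≤ : ∀ t u v → lowest-differing-bit t u v ≤ t
lowest-differing-bit≤ zero    u v = z≤n
lowest-differing-bit≤ (suc t) u v with bit 0 u Bool.≟ bit 0 v
... | yes _ = s≤s (lowest-differing-bit≤ t (u / 2) (v / 2))
... | no  _ = z≤n

lowest-differing-bit-sym : ∀ t u v → lowest-differing-bit t u v ≡ lowest-differing-bit t v u
lowest-differing-bit-sym zero    u v = refl
lowest-differing-bit-sym (suc t) u v with bit 0 u Bool.≟ bit 0 v | bit 0 v Bool.≟ bit 0 u
... | yes _  | yes _  = cong suc (lowest-differing-bit-sym t (u / 2) (v / 2))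
... | no  _  | no  _  = refl
... | yes eq | no ne  = contradiction (sym eq) ne
... | no ne  | yes eq = contradiction (sym eq) ne

bit0-injective : ∀ {u v} → bit 0 u ≡ bit 0 v → u % 2 ≡ v % 2
bit0-injective {u} {v} eq = trans (digit (m%n<n u 2)) (trans (cong (λ b → if b then 1 else 0) eq) (sym (digit (m%n<n v 2))))
  where
  digit : ∀ {r} → r < 2 → r ≡ (if r ≡ᵇ 1 then 1 else 0)
  digit {0} _ = refl
  digit {1} _ = refl
  digit {2+ _} (s≤s (s≤s ()))

lowest-differing-bit-differs : ∀ t {u v} → u ≢ v → u < 2 ^ t → v < 2 ^ t →
                               bit (lowest-differing-bit t u v) u ≢ bit (lowest-differing-bit t u v) v
lowest-differing-bit-differs zero    u≢v (s≤s z≤n) (s≤s z≤n) = contradiction refl u≢v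
lowest-differing-bit-differs (suc t) {u} {v} u≢v u<2^[1+t] v<2^[1+t] with bit 0 u Bool.≟ bit 0 v
... | no  bit0≢ = bit0≢
... | yes bit0≡ = lowest-differing-bit-differs t halves-differ (half u<2^[1+t]) (half v<2^[1+t])
  where
  halves-differ : u / 2 ≢ v / 2
  halves-differ u/2≡v/2 = u≢v (begin
    u                  ≡⟨ m≡m%n+[m/n]*n u 2 ⟩
    u % 2 + u / 2 * 2  ≡⟨ cong₂ (λ r q → r + q * 2) (bit0-injective {u} {v} bit0≡) u/2≡v/2 ⟩
    v % 2 + v / 2 * 2  ≡⟨ m≡m%n+[m/n]*n v 2 ⟨
    v                  ∎)
    where open ≡-Reasoning
  half : ∀ {z} → z < 2 ^ suc t → z / 2 < 2 ^ t
  half {z} z< = m<n*o⇒m/o<n (subst (z <_) (*-comm 2 (2 ^ t)) z<)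

<?-antisymmetric : ∀ {a b} → a ≢ b → (a<b? : Dec (a < b)) (b<a? : Dec (b < a)) → does a<b? ≢ does b<a?
<?-antisymmetric a≢b (yes a<b) (yes b<a) = contradiction b<a (<-asym a<b)
<?-antisymmetric a≢b (yes _)   (no  _)   = λ ()
<?-antisymmetric a≢b (no  _)   (yes _)   = λ ()
<?-antisymmetric a≢b (no  a≮b) (no  b≮a) = contradiction (≤-antisym (≮⇒≥ b≮a) (≮⇒≥ a≮b)) a≢b

module BlockTagging {p} (p-prime : Prime p) (T : ℕ) where

  open PrimeModulus p-prime

  private instance
    p≢0 : NonZero p
    p≢0 = prime⇒nonZero p-prime

  -- Tags up to T are bit positions (pairs inside one block); the tag T + 1 + s joins the
  -- blocks b, b′ with b + b′ = s, and its sides are the smaller and the larger block.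
  tag : ℕ → ℕ → ℕ
  tag u v with block u ≟ block v
  ... | yes _ = lowest-differing-bit T u v
  ... | no  _ = suc T + (block u + block v)

  side : ℕ → ℕ → Bool
  side a z with a <? suc T
  ... | yes _ = bit a z
  ... | no  _ = does (block z <? a ∸ suc T ∸ block z)

  tag-sym : ∀ u v → tag u v ≡ tag v u
  tag-sym u v with block u ≟ block v | block v ≟ block u
  ... | yes _  | yes _  = lowest-differing-bit-sym T u v
  ... | no  _  | no  _  = cong (suc T +_) (+-comm (block u) (block v))
  ... | yes eq | no ne  = contradiction (sym eq) ne
  ... | no ne  | yes eq = contradiction (sym eq) ne

  lowest-differing-bit≢cross-tag : ∀ u v s → lowest-differing-bit T u v ≢ suc T + s
  lowest-differing-bit≢cross-tag u v s = <⇒≢ (s≤s (≤-trans (lowest-differing-bit≤ T u v) (m≤m+n T s)))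

  tag-block : ∀ {x y z} → tag x y ≡ tag z y → block x ≡ block z
  tag-block {x} {y} {z} eq with block x ≟ block y | block z ≟ block y
  ... | yes bx≡by | yes bz≡by = trans bx≡by (sym bz≡by)
  ... | yes _     | no  _     = contradiction eq (lowest-differing-bit≢cross-tag x y (block z + block y))
  ... | no  _     | yes _     = contradiction (sym eq) (lowest-differing-bit≢cross-tag z y (block x + block y))
  ... | no  _     | no  _     = +-cancelʳ-≡ (block y) (block x) (block z) (+-cancelˡ-≡ (suc T) _ _ eq)

  tag-proper : ∀ {u v} → u ≢ v → u < 2 ^ T → v < 2 ^ T → side (tag u v) u ≢ side (tag u v) v
  tag-proper {u} {v} u≢v u<2^T v<2^T with block u ≟ block v
  ... | yes _ with lowest-differing-bit T u v <? suc T
  ...   | yes _ = lowest-differing-bit-differs T u≢v u<2^T v<2^T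
  ...   | no  ≮T+1 = contradiction (s≤s (lowest-differing-bit≤ T u v)) ≮T+1
  tag-proper {u} {v} u≢v u<2^T v<2^T | no bu≢bv with suc T + (block u + block v) <? suc T
  ...   | yes lt = contradiction lt (m+n≮m (suc T) _)
  ...   | no  _ rewrite m+n∸m≡n (suc T) (block u + block v) | m+n∸m≡n (block u) (block v) | m+n∸n≡m (block u) (block v) =
    <?-antisymmetric bu≢bv (block u <? block v) (block v <? block u)

  block< : ∀ {M z} → z < M * (p * p) → block z < M
  block< {M} {z} z< = m<n*o⇒m/o<n (m<n*o⇒m/o<n (subst (z <_) (sym (*-assoc M p p)) z<))

  tag-bound : ∀ {M u v} → u < M * (p * p) → v < M * (p * p) → tag u v < suc T + (M + M)
  tag-bound {M} {u} {v} u< v< with block u ≟ block v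
  ... | yes _ = s≤s (≤-trans (lowest-differing-bit≤ T u v) (m≤m+n T (M + M)))
  ... | no  _ = +-monoʳ-< (suc T) (+-mono-< (block< {M} u<) (block< {M} v<))

-- Refining a tagging by a quadratic form

module QuadraticRefinement {p} (p-prime : Prime p) {n K : ℕ}
  (tag : ℕ → ℕ → ℕ) (side : ℕ → ℕ → Bool)
  (tag-sym : ∀ u v → tag u v ≡ tag v u)
  (tag-bound : ∀ {u v} → u < n → v < n → tag u v < K)
  (tag-proper : ∀ {u v} → u ≢ v → u < n → v < n → side (tag u v) u ≢ side (tag u v) v)
  (tag-block : ∀ {x y z} → tag x y ≡ tag z y → PrimeModulus.block p-prime x ≡ PrimeModulus.block p-prime z)
  where

  open PrimeModulus p-prime

  private instance
    p≢0 : NonZero p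
    p≢0 = prime⇒nonZero p-prime

  edge-value : ℕ → ℕ → ℕ
  edge-value u v = if side (tag u v) u then quadratic v u else quadratic u v

  edge-value<p : ∀ u v → edge-value u v < p
  edge-value<p u v with side (tag u v) u
  ... | true  = m%n<n _ p
  ... | false = m%n<n _ p

  edge-value-left : ∀ {u v} → side (tag u v) u ≡ false → edge-value u v ≡ quadratic u v
  edge-value-left {u} {v} left rewrite left = refl

  edge-value-sym : ∀ {u v} → u ≢ v → u < n → v < n → edge-value u v ≡ edge-value v u
  edge-value-sym {u} {v} u≢v u<n v<n rewrite tag-sym v u with side (tag u v) u in su | side (tag u v) v in sv
  ... | true  | false = refl
  ... | false | true  = refl
  ... | true  | true  = contradiction (trans su (sym sv)) (tag-proper u≢v u<n v<n)
  ... | false | false = contradiction (trans su (sym sv)) (tag-proper u≢v u<n v<n)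

  colour-tag : Fin n → Fin n → Fin K
  colour-tag u v = fromℕ< (tag-bound (toℕ<n u) (toℕ<n v))

  colour-value : Fin n → Fin n → Fin p
  colour-value u v = fromℕ< (edge-value<p (toℕ u) (toℕ v))

  colour : EdgeColouring n (K * p)
  colour u v = combine (colour-tag u v) (colour-value u v)

  class-tag class-value : Fin (K * p) → ℕ
  class-tag i = toℕ (proj₁ (remQuot {K} p i))
  class-value i = toℕ (proj₂ (remQuot {K} p i))

  class-side : Fin (K * p) → Fin n → Bool
  class-side i z = side (class-tag i) (toℕ z)

  colour-class : ∀ {u v i} → colour u v ≡ i →
                 tag (toℕ u) (toℕ v) ≡ class-tag i × edge-value (toℕ u) (toℕ v) ≡ class-value i
  colour-class {u} {v} refl =
    sym (trans (cong (toℕ ∘ proj₁) decode) (toℕ-fromℕ< _)) , sym (trans (cong (toℕ ∘ proj₂) decode) (toℕ-fromℕ< _))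
    where
    decode : remQuot {K} p (colour u v) ≡ (colour-tag u v , colour-value u v)
    decode = remQuot-combine (colour-tag u v) (colour-value u v)

  toℕ-≢ : ∀ {u v : Fin n} → u ≢ v → toℕ u ≢ toℕ v
  toℕ-≢ u≢v = u≢v ∘ toℕ-injective

  colour-sym : Symmetric colour
  colour-sym u v u≢v = cong₂ combine
    (fromℕ<-cong _ _ {K} (tag-sym (toℕ u) (toℕ v)) _ _)
    (fromℕ<-cong _ _ {p} (edge-value-sym (toℕ-≢ u≢v) (toℕ<n u) (toℕ<n v)) _ _)

  class-proper : ∀ {u v i} → u ≢ v → colour u v ≡ i → class-side i u ≢ class-side i v
  class-proper {u} {v} u≢v cuv≡i = subst (λ a → side a (toℕ u) ≢ side a (toℕ v)) (proj₁ (colour-class cuv≡i))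
                                         (tag-proper (toℕ-≢ u≢v) (toℕ<n u) (toℕ<n v))

  Edge : Fin (K * p) → Fin n → Fin n → Set
  Edge i u v = u ≢ v × colour u v ≡ i

  Edge-sym : ∀ {i u v} → Edge i u v → Edge i v u
  Edge-sym {u = u} {v} (u≢v , cuv≡i) = ≢-sym u≢v , trans (colour-sym v u (≢-sym u≢v)) cuv≡i

  left-value : ∀ {i l r} → Edge i l r → class-side i l ≡ false → quadratic (toℕ l) (toℕ r) ≡ class-value i
  left-value (l≢r , clr≡i) left = trans (sym (edge-value-left (trans (cong (λ a → side a _) (proj₁ (colour-class clr≡i))) left)))
                                        (proj₂ (colour-class clr≡i))

  class-opposite : ∀ {i u v} → Edge i u v → class-side i v ≡ not (class-side i u)
  class-opposite (u≢v , cuv≡i) = ¬-not (≢-sym (class-proper u≢v cuv≡i))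

  rectangle-free : ∀ {i l₁ r₁ l₂ r₂} → l₁ ≢ l₂ → r₁ ≢ r₂ →
                   Edge i l₁ r₁ → Edge i l₂ r₁ → Edge i l₂ r₂ → Edge i l₁ r₂ → class-side i l₁ ≡ false → ⊥
  rectangle-free {i} {l₁} {r₁} {l₂} {r₂} l₁≢l₂ r₁≢r₂ e₁₁ e₂₁ e₂₂ e₁₂ left₁ =
    [ l₁≢l₂ ∘ toℕ-injective , r₁≢r₂ ∘ toℕ-injective ]
      (quadratic-rectangle same-block-l same-block-r (trans q₁₁ (sym q₂₁)) (trans q₁₂ (sym q₂₂)) (trans q₁₁ (sym q₁₂)))
    where
    left₂ : class-side i l₂ ≡ false
    left₂ = trans (class-opposite (Edge-sym e₂₁)) (cong not (trans (class-opposite e₁₁) (cong not left₁)))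
    q₁₁ : quadratic (toℕ l₁) (toℕ r₁) ≡ class-value i
    q₁₁ = left-value e₁₁ left₁
    q₂₁ : quadratic (toℕ l₂) (toℕ r₁) ≡ class-value i
    q₂₁ = left-value e₂₁ left₂
    q₂₂ : quadratic (toℕ l₂) (toℕ r₂) ≡ class-value i
    q₂₂ = left-value e₂₂ left₂
    q₁₂ : quadratic (toℕ l₁) (toℕ r₂) ≡ class-value i
    q₁₂ = left-value e₁₂ left₁
    tag≡ : ∀ {u v} → Edge i u v → tag (toℕ u) (toℕ v) ≡ class-tag i
    tag≡ = proj₁ ∘ colour-class ∘ proj₂
    same-block-l : block (toℕ l₁) ≡ block (toℕ l₂)
    same-block-l = tag-block (trans (tag≡ e₁₁) (sym (tag≡ e₂₁)))
    same-block-r : block (toℕ r₁) ≡ block (toℕ r₂)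
    same-block-r = tag-block (trans (tag≡ (Edge-sym e₁₁)) (sym (tag≡ (Edge-sym e₁₂))))

  no-4-cycle : ∀ {i v₀ v₁ v₂ v₃} → v₀ ≢ v₂ → v₁ ≢ v₃ →
               Edge i v₀ v₁ → Edge i v₁ v₂ → Edge i v₂ v₃ → Edge i v₃ v₀ → ⊥
  no-4-cycle {i} {v₀} v₀≢v₂ v₁≢v₃ e₀₁ e₁₂ e₂₃ e₃₀ with class-side i v₀ in side₀
  ... | false = rectangle-free v₀≢v₂ v₁≢v₃ e₀₁ (Edge-sym e₁₂) e₂₃ (Edge-sym e₃₀) side₀
  ... | true  = rectangle-free v₁≢v₃ v₀≢v₂ (Edge-sym e₀₁) e₃₀ (Edge-sym e₂₃) e₁₂ (trans (class-opposite e₀₁) (cong not side₀))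

  -- The parts contain no 4-cycle at all, induced or not.
  partition : HasPartition n (K * p)
  partition = colour , colour-sym , (λ i → class-side i , λ u v u≢v cuv≡i → class-proper u≢v cuv≡i) ,
    λ { i (v₀ , v₁ , v₂ , v₃ , (v₀≢v₁ , v₀≢v₂ , v₀≢v₃ , v₁≢v₂ , v₁≢v₃ , v₂≢v₃) , (c₀₁ , c₁₂ , c₂₃ , c₃₀) , _) →
        no-4-cycle v₀≢v₂ v₁≢v₃ (v₀≢v₁ , c₀₁) (v₁≢v₂ , c₁₂) (v₂≢v₃ , c₂₃) (≢-sym v₀≢v₃ , c₃₀) }

-- Choice of the parameters

blockwise-partition : ∀ {p T M n} → Prime p → n ≤ 2 ^ T → n ≤ M * (p * p) → HasPartition n ((suc T + (M + M)) * p)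
blockwise-partition {p} {T} {M} p-prime n≤2^T n≤Mp² =
  QuadraticRefinement.partition p-prime tag side tag-sym
    (λ u<n v<n → tag-bound {M} (<-≤-trans u<n n≤Mp²) (<-≤-trans v<n n≤Mp²))
    (λ u≢v u<n v<n → tag-proper u≢v (<-≤-trans u<n n≤2^T) (<-≤-trans v<n n≤2^T))
    tag-block
  where open BlockTagging p-prime T

sqrt-bracket : ∀ n → ∃[ s ] s * s ≤ n × n < suc s * suc s
sqrt-bracket zero    = 0 , z≤n , s≤s z≤n
sqrt-bracket (suc n) with sqrt-bracket n
... | s , s²≤n , n<[1+s]² with suc s * suc s ≤? suc n
...   | yes [1+s]²≤1+n = suc s , [1+s]²≤1+n , ≤-<-trans n<[1+s]² (*-mono-< (n<1+n (suc s)) (n<1+n (suc s)))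
...   | no  [1+s]²≰1+n = s , m≤n⇒m≤1+n s²≤n , ≰⇒> [1+s]²≰1+n

division-bracket : ∀ a d .{{_ : NonZero d}} → d * (a / d) ≤ a × a < d * suc (a / d)
division-bracket a d =
  subst (_≤ a) (*-comm (a / d) d) (m/n*n≤m a d) ,
  subst (a <_) (*-comm (suc (a / d)) d)
        (subst (_< suc (a / d) * d) (sym (m≡m%n+[m/n]*n a d)) (+-monoˡ-< (a / d * d) (m%n<n a d)))

n<2^[1+⌊log₂n⌋] : ∀ n → n < 2 ^ suc ⌊log₂ n ⌋
n<2^[1+⌊log₂n⌋] n with n <? 2 ^ suc ⌊log₂ n ⌋
... | yes n<2^[1+L] = n<2^[1+L]
... | no  n≮2^[1+L] =
  contradiction (subst (_≤ ⌊log₂ n ⌋) (⌊log₂[2^n]⌋≡n (suc ⌊log₂ n ⌋)) (⌊log₂⌋-mono-≤ (≮⇒≥ n≮2^[1+L])))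
                (<⇒≱ (n<1+n ⌊log₂ n ⌋))

1≤⌊log₂n⌋ : ∀ {n} → 2 ≤ n → 1 ≤ ⌊log₂ n ⌋
1≤⌊log₂n⌋ 2≤n = ⌊log₂⌋-mono-≤ 2≤n

prime-between-s/2T-and-s : ∀ {s} T .{{_ : NonZero T}} → 3 ≤ s → s ≤ 2 ^ T → ∃[ p ] Prime p × p ≤ s × s ≤ 2 * (T * p) + 2
prime-between-s/2T-and-s {suc s} T (s≤s 2≤s) 1+s≤2^T =
  let p , p-prime , y<p , p≤1+2m = prime-in-range m T y (≤-trans 1+2m≤1+s 1+s≤2^T) Ty<m
  in  p , p-prime , ≤-trans p≤1+2m 1+2m≤1+s , 1+s≤2Tp+2 y<p
  where
  m y : ℕ
  m = s / 2
  y = pred m / T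
  1≤m : 1 ≤ m
  1≤m = m≥n⇒m/n>0 2≤s
  m≡1+[m-1] : m ≡ suc (pred m)
  m≡1+[m-1] = sym (suc-pred m {{>-nonZero 1≤m}})
  1+2m≤1+s : suc (m + m) ≤ suc s
  1+2m≤1+s = s≤s (subst (_≤ s) (cong (m +_) (+-identityʳ m)) (proj₁ (division-bracket s 2)))
  Ty<m : T * y < m
  Ty<m = ≤-<-trans (proj₁ (division-bracket (pred m) T)) (subst (pred m <_) (sym m≡1+[m-1]) ≤-refl)
  1+s≤2Tp+2 : ∀ {p} → y < p → suc s ≤ 2 * (T * p) + 2
  1+s≤2Tp+2 {p} y<p = begin
    suc s              ≤⟨ proj₂ (division-bracket s 2) ⟩
    2 * suc m          ≡⟨ *-distribˡ-+ 2 1 m ⟩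
    2 + 2 * m          ≤⟨ +-monoʳ-≤ 2 (*-monoʳ-≤ 2 m≤Tp) ⟩
    2 + 2 * (T * p)    ≡⟨ +-comm 2 _ ⟩
    2 * (T * p) + 2    ∎
    where
    open ≤-Reasoning
    m≤Tp : m ≤ T * p
    m≤Tp = ≤-trans (subst (_≤ T * suc y) (sym m≡1+[m-1]) (proj₂ (division-bracket (pred m) T))) (*-monoʳ-≤ T y<p)

ceiling-bracket : ∀ n q .{{_ : NonZero q}} → n ≤ suc (n / q) * q × suc (n / q) * q ≤ n + q
ceiling-bracket n q =
  subst (n ≤_) (*-comm q (suc (n / q))) (<⇒≤ (proj₂ (division-bracket n q))) ,
  subst (_≤ n + q) (+-comm (n / q * q) q) (+-monoˡ-≤ q (m/n*n≤m n q))

3≤√n : ∀ {n s} → 9 ≤ n → n < suc s * suc s → 3 ≤ s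
3≤√n {n} {s} 9≤n n<[1+s]² with 3 ≤? s
... | yes 3≤s = 3≤s
... | no  3≰s = contradiction (<-≤-trans n<[1+s]² (*-mono-≤ (≰⇒> 3≰s) (≰⇒> 3≰s))) (≤⇒≯ 9≤n)

-- With p ≤ s ≤ 4Tp and M p² ≤ 2n, both summands of k = (T + 1) p + 2 M p are O(T n / s).
colours×√n≤17[T+1]n : ∀ {n s p T M} → 1 ≤ T → 1 ≤ p → s * s ≤ n → p ≤ s → s ≤ 2 * (T * p) + 2 →
                      M * (p * p) ≤ n + p * p → (suc T + (M + M)) * p * s ≤ 17 * suc T * n
colours×√n≤17[T+1]n {n} {s} {p} {T} {M} 1≤T 1≤p s²≤n p≤s s≤2Tp+2 Mp²≤n+p² = begin
  (suc T + (M + M)) * p * s           ≡⟨ split T M p s ⟩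
  suc T * (p * s) + 2 * (M * p * s)   ≤⟨ +-mono-≤ (*-monoʳ-≤ (suc T) ps≤n) (*-monoʳ-≤ 2 Mps≤8Tn) ⟩
  suc T * n + 2 * (8 * T * n)         ≤⟨ +-monoʳ-≤ (suc T * n) (*-monoʳ-≤ 2 (*-monoˡ-≤ n (*-monoʳ-≤ 8 (n≤1+n T)))) ⟩
  suc T * n + 2 * (8 * suc T * n)     ≡⟨ collect (suc T) n ⟩
  17 * suc T * n                      ∎
  where
  open ≤-Reasoning
  split : ∀ T M p s → (suc T + (M + M)) * p * s ≡ suc T * (p * s) + 2 * (M * p * s)
  split = solve-∀
  collect : ∀ t n → t * n + 2 * (8 * t * n) ≡ 17 * t * n
  collect = solve-∀
  ps≤n : p * s ≤ n
  ps≤n = ≤-trans (*-monoˡ-≤ s p≤s) s²≤n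
  p²≤n : p * p ≤ n
  p²≤n = ≤-trans (*-monoʳ-≤ p p≤s) ps≤n
  s≤4Tp : s ≤ 4 * (T * p)
  s≤4Tp = ≤-trans s≤2Tp+2 (≤-trans (+-monoʳ-≤ (2 * (T * p)) (*-monoʳ-≤ 2 (*-mono-≤ 1≤T 1≤p)))
                                   (≤-reflexive (double (T * p))))
    where
    double : ∀ a → 2 * a + 2 * a ≡ 4 * a
    double = solve-∀
  Mps≤8Tn : M * p * s ≤ 8 * T * n
  Mps≤8Tn = begin
    M * p * s                ≤⟨ *-monoʳ-≤ (M * p) s≤4Tp ⟩
    M * p * (4 * (T * p))    ≡⟨ regroup M p T ⟩
    4 * T * (M * (p * p))    ≤⟨ *-monoʳ-≤ (4 * T) (≤-trans Mp²≤n+p² (+-monoʳ-≤ n p²≤n)) ⟩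
    4 * T * (n + n)          ≡⟨ twice T n ⟩
    8 * T * n                ∎
    where
    regroup : ∀ M p T → M * p * (4 * (T * p)) ≡ 4 * T * (M * (p * p))
    regroup = solve-∀
    twice : ∀ T n → 4 * T * (n + n) ≡ 8 * T * n
    twice = solve-∀

a√n≤bn⇒a²≤4b²n : ∀ {a b n s} → 1 ≤ s → n < suc s * suc s → a * s ≤ b * n → a * a ≤ 4 * (b * b) * n
a√n≤bn⇒a²≤4b²n {a} {b} {n} {s} 1≤s n<[1+s]² as≤bn = *-cancelʳ-≤ (a * a) _ (s * s) {{>-nonZero (*-mono-≤ 1≤s 1≤s)}} (begin
  a * a * (s * s)              ≡⟨ square-product a s ⟩
  (a * s) * (a * s)            ≤⟨ *-mono-≤ as≤bn as≤bn ⟩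
  (b * n) * (b * n)            ≡⟨ square-product b n ⟨
  b * b * (n * n)              ≡⟨ *-assoc (b * b) n n ⟨
  b * b * n * n                ≤⟨ *-monoʳ-≤ (b * b * n) n≤4s² ⟩
  b * b * n * (4 * (s * s))    ≡⟨ regroup (b * b) n (s * s) ⟩
  4 * (b * b) * n * (s * s)    ∎)
  where
  open ≤-Reasoning
  square-product : ∀ a s → a * a * (s * s) ≡ (a * s) * (a * s)
  square-product = solve-∀
  regroup : ∀ c n q → c * n * (4 * q) ≡ 4 * c * n * q
  regroup = solve-∀
  n≤4s² : n ≤ 4 * (s * s)
  n≤4s² = ≤-trans (<⇒≤ n<[1+s]²) (≤-trans (*-mono-≤ 1+s≤2s 1+s≤2s) (≤-reflexive (square-double s)))
    where
    1+s≤2s : suc s ≤ 2 * s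
    1+s≤2s = ≤-trans (+-monoˡ-≤ s 1≤s) (≤-reflexive (cong (s +_) (sym (+-identityʳ s))))
    square-double : ∀ s → 2 * s * (2 * s) ≡ 4 * (s * s)
    square-double = solve-∀

4[17[L+2]]²n≤102²nL² : ∀ {L n} → 1 ≤ L → 4 * (17 * suc (suc L) * (17 * suc (suc L))) * n ≤ 102 * 102 * n * (L * L)
4[17[L+2]]²n≤102²nL² {L} {n} 1≤L = begin
  4 * (17 * suc (suc L) * (17 * suc (suc L))) * n
    ≤⟨ *-monoˡ-≤ n (*-monoʳ-≤ 4 (*-mono-≤ (*-monoʳ-≤ 17 2+L≤3L) (*-monoʳ-≤ 17 2+L≤3L))) ⟩
  4 * (17 * (3 * L) * (17 * (3 * L))) * n
    ≡⟨ collect L n ⟩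
  102 * 102 * n * (L * L) ∎
  where
  open ≤-Reasoning
  collect : ∀ L n → 4 * (17 * (3 * L) * (17 * (3 * L))) * n ≡ 102 * 102 * n * (L * L)
  collect = solve-∀
  2+L≤3L : suc (suc L) ≤ 3 * L
  2+L≤3L = ≤-trans (+-monoˡ-≤ L (+-mono-≤ 1≤L 1≤L)) (≤-reflexive (three L))
    where
    three : ∀ L → L + L + L ≡ 3 * L
    three = solve-∀

upper-bound : ∀ {n} → 9 ≤ n → ∃[ k ] HasPartition n k × k * k ≤ 102 * 102 * n * (⌊log₂ n ⌋ * ⌊log₂ n ⌋)
upper-bound {n} 9≤n =
  let s , s²≤n , n<[1+s]²       = sqrt-bracket n
      3≤s : 3 ≤ s
      3≤s = 3≤√n 9≤n n<[1+s]²
      s≤2^T : s ≤ 2 ^ T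
      s≤2^T = ≤-trans (≤-trans (m≤m*n s s {{>-nonZero (<-trans z<s 3≤s)}}) s²≤n) n≤2^T
      p , p-prime , p≤s , s≤2Tp+2 = prime-between-s/2T-and-s T 3≤s s≤2^T
      instance
        p²≢0 : NonZero (p * p)
        p²≢0 = m*n≢0 p p {{prime⇒nonZero p-prime}} {{prime⇒nonZero p-prime}}
      M : ℕ
      M = suc (n / (p * p))
      n≤Mp² , Mp²≤n+p² = ceiling-bracket n (p * p)
      k : ℕ
      k = (suc T + (M + M)) * p
  in  k , blockwise-partition {T = T} {M} p-prime n≤2^T n≤Mp² ,
      ≤-trans (a√n≤bn⇒a²≤4b²n {k} {17 * suc T} (<-trans z<s 3≤s) n<[1+s]²
                 (colours×√n≤17[T+1]n {T = T} {M} (s≤s z≤n) (<-trans z<s (prime⇒2≤ p-prime)) s²≤n p≤s s≤2Tp+2 Mp²≤n+p²))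
              (4[17[L+2]]²n≤102²nL² {⌊log₂ n ⌋} {n} (1≤⌊log₂n⌋ (≤-trans (s≤s (s≤s z≤n)) 9≤n)))
  where
  T : ℕ
  T = suc ⌊log₂ n ⌋
  n≤2^T : n ≤ 2 ^ T
  n≤2^T = <⇒≤ (n<2^[1+⌊log₂n⌋] n)

-- a = 1/3 and b = 102 in the informal statement, valid from n = 9 on.
mainTheorem2 : Σ ℕ λ A → Σ ℕ λ B → Σ ℕ λ N →
      (1 ≤ A) × (1 ≤ B) ×
      ((n : ℕ) → N ≤ n →
        ((k : ℕ) → HasPartition n k → n ≤ A * A * (k * k)) ×
        (Σ ℕ λ k → HasPartition n k ×
          (k * k ≤ B * B * n * (⌊log₂ n ⌋ * ⌊log₂ n ⌋))))
mainTheorem2 = 3 , 102 , 9 , s≤s z≤n , s≤s z≤n , λ n 9≤n →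
  (λ k → lower-bound (≤-trans (s≤s (s≤s z≤n)) 9≤n)) , upper-bound 9≤n
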